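{- Let $H$ be an $r$-partite $r$-uniform hypergraph on vertex set $V$ with $m$ edges and vertex classes $V_1,\dots,V_r$ (each edge containing exactly one vertex of each $V_i$), $|V_i|=n_i\ge1$, and let $s_r(H)=\sum_{i=1}^r\sum_{j\in V_i}\left|d_H(j)-\frac{m}{n_i}\right|$. Then there exists an $r$-uniform hypergraph $\widehat H$ on vertex set $V$, $r$-partite with respect to the classes $V_1,\dots,V_r$, such that $|d_{\widehat H}(i)-d_{\widehat H}(j)|\le 1$ whenever $i,j$ belong to the same class $V_k$, and $|E(H)\,\triangle\,E(\widehat H)|\le s_r(H)$ (i.e. $\widehat H$ differs from $H$ in at most $s_r(H)$ edges).
   Context: An $r$-uniform hypergraph has as edges a set of $r$-element subsets of its vertex set (no multiple edges). $d_H(i)$ is the number of edges of $H$ containing vertex $i$. An $r$-uniform hypergraph is $r$-partite with respect to a partition into $r$ classes if each edge contains at most one vertex from each class. -}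

module Defs where

open import Data.Nat as ℕ using (ℕ; zero; suc; _>_; >-nonZero)
open import Data.Fin using (Fin; zero; suc)
open import Data.Fin.Properties using (all?)
open import Data.List using (List; filter; length)
open import Data.List.Relation.Unary.AllPairs using (AllPairs)
open import Data.List.Relation.Unary.Any using (Any)
open import Data.List.Relation.Unary.Any.Properties using ()
import Data.List.Relation.Unary.Any as Any
open import Data.Integer using (+_)
open import Data.Rational as ℚ using (ℚ; 0ℚ)
open import Relation.Binary.PropositionalEquality using (_≡_)
open import Relation.Nullary using (¬_; Dec; ¬?)

import Data.Fin.Properties as FinP

-- Vertex classes V_1..V_r are indexed by Fin r; class i is Fin (n i),
-- so the vertex set V is the disjoint union Σ i, Fin (n i).
-- An edge of an r-partite r-uniform hypergraph with respect to these
-- classes contains exactly one vertex of each class, i.e. it is a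
-- choice function picking a vertex in each class.
Edge : (r : ℕ) → (Fin r → ℕ) → Set
Edge r n = (i : Fin r) → Fin (n i)

_≈E_ : ∀ {r n} → Edge r n → Edge r n → Set
e ≈E f = ∀ i → e i ≡ f i

_≈E?_ : ∀ {r n} (e f : Edge r n) → Dec (e ≈E f)
e ≈E? f = all? (λ i → e i FinP.≟ f i)

record Hypergraph (r : ℕ) (n : Fin r → ℕ) : Set where
  field
    edges    : List (Edge r n)
    distinct : AllPairs (λ e f → ¬ (e ≈E f)) edges
open Hypergraph public

numEdges : ∀ {r n} → Hypergraph r n → ℕ
numEdges H = length (edges H)

deg : ∀ {r n} → Hypergraph r n → (i : Fin r) → Fin (n i) → ℕ
deg H i j = length (filter (λ e → e i FinP.≟ j) (edges H))

_∈E_ : ∀ {r n} → Edge r n → Hypergraph r n → Set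
e ∈E H = Any (λ f → e ≈E f) (edges H)

_∈E?_ : ∀ {r n} (e : Edge r n) (H : Hypergraph r n) → Dec (e ∈E H)
e ∈E? H = Any.any? (λ f → e ≈E? f) (edges H)

diffSize : ∀ {r n} → Hypergraph r n → Hypergraph r n → ℕ
diffSize H G = length (filter (λ e → ¬? (e ∈E? G)) (edges H))

symDiffSize : ∀ {r n} → Hypergraph r n → Hypergraph r n → ℕ
symDiffSize H G = diffSize H G ℕ.+ diffSize G H

sumFin : (k : ℕ) → (Fin k → ℚ) → ℚ
sumFin zero    f = 0ℚ
sumFin (suc k) f = f zero ℚ.+ sumFin k (λ i → f (suc i))

s-r : ∀ {r n} → (∀ i → n i > 0) → Hypergraph r n → ℚ
s-r {r} {n} pos H =
  sumFin r (λ i → sumFin (n i) (λ j →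
    ℚ.∣ (+ deg H i j ℚ./ 1) ℚ.- ((+ numEdges H ℚ./ n i) {{>-nonZero (pos i)}}) ∣))

-- Balance the classes one at a time; rebalancing class k changes no degree outside it.
-- In class k let q = ⌊m/n_k⌋. Its degrees sum to m, so the class is balanced once they all lie
-- in {q, q+1}. Let A be the total excess of its degrees over q+1 and B their total shortfall
-- below q. While the class is unbalanced, pick u with d(u) > q and v with d(v) ≤ q, insisting
-- on d(u) > q+1 if A > 0 and on d(v) < q if B > 0. Replacing u by v is injective on the edges
-- through u, so as d(v) < d(u) some edge through u is not sent onto an existing edge; exchanging
-- the two costs 2 in the symmetric difference and lowers max(A, B). Hence class k costs at most
-- 2 max(A, B), while n_k max(A, B) is at most half the sum over j of |n_k d(j) - m|, because
-- the positive and negative parts of n_k d(j) - m have equal sums. Divide by n_k, sum over k.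

module Submission where

open import Data.Fin using (Fin; zero; suc)
import Data.Fin.Properties as Fin
open import Data.Integer as ℤ using (ℤ)
import Data.Integer.Properties as ℤP
open import Data.Integer.Tactic.RingSolver using (solve-∀)
open import Data.List as List using (List; []; _∷_; [_]; length; filter; tabulate; allFin)
open import Data.List.Properties using (length-removeAt′; filter-none; map-tabulate)
import Data.List.Membership.Propositional as PropositionalMembership
open import Data.List.Membership.Propositional.Properties using (∈-allFin)
import Data.List.Membership.Setoid as SetoidMembership
open import Data.List.Membership.Setoid using (lose)
open import Data.List.Membership.Setoid.Properties
  using (All[≉]⇒∉; ∈-resp-≈; ∉-resp-≈; ∈-filter⁺; ∈-filter⁻)
open import Data.List.Relation.Unary.All as All using (All)
import Data.List.Relation.Unary.All.Properties as All
open import Data.List.Relation.Unary.AllPairs using (AllPairs; []; _∷_)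
open import Data.List.Relation.Unary.Any as Any using (Any; here; there; index; _─_)
open import Data.List.Relation.Unary.Any.Properties using (lookup-result)
import Data.List.Relation.Unary.Unique.Propositional as PropositionalUnique
open import Data.List.Relation.Unary.Unique.Propositional.Properties using (allFin⁺)
import Data.List.Relation.Unary.Unique.Setoid as SetoidUnique
import Data.List.Relation.Unary.Unique.Setoid.Properties as Unique
open import Data.Nat
  using (ℕ; zero; suc; pred; NonZero; >-nonZero; _>_; _+_; _*_; _∸_; _⊔_; ∣_-_∣; _<?_; _≤?_; _≤_; _<_; z≤n; s≤s)
open import Data.Nat.DivMod using (_/_; _%_; m/n*n≤m; m≡m%n+[m/n]*n; m%n<n)
import Data.Nat.ListAction as ListAction
open import Data.Nat.Properties
  using ( +-*-semiring; +-commutativeSemigroup; *-commutativeSemigroup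
        ; ≤-refl; ≤-reflexive; ≤-trans; ≤-<-trans; ≤-total; ≤-pred; <⇒≤; <⇒≱; ≤⇒≯; ≮⇒≥; ≰⇒>; n≤0⇒n≡0
        ; +-comm; +-suc; +-identityʳ; +-cancelʳ-≡; m≤m+n; +-mono-≤; +-monoʳ-≤; +-monoˡ-<; +-mono-<-≤; +-mono-≤-<
        ; *-comm; *-suc; *-identityˡ; *-identityʳ; *-monoʳ-≤; *-distribˡ-∸; *-distribˡ-⊔
        ; ∸-mono; ∸-monoˡ-≤; ∸-monoʳ-≤; ∸-monoˡ-<; ∸-monoʳ-<; m+n∸n≡m; m≤n⇒m∸n≡0
        ; ⊔-lub; ⊔-mono-<; ⊔-identityʳ; m≤m⊔n; m≤n⊔m
        ; ∣m-n∣≡[m∸n]∨[n∸m]; m≤n⇒∣m-n∣≡n∸m; m≤n⇒∣n-m∣≡n∸m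
        ; module ≤-Reasoning
        )
open import Algebra.Properties.Semiring.Sum +-*-semiring
  using (sum; sum-syntax; sum-cong-≗; sum-replicate-zero; ∑-distrib-+; *-distribˡ-sum)
open import Algebra.Properties.CommutativeSemigroup +-commutativeSemigroup
  using (interchange; xy∙z≈zy∙x; x∙yz≈y∙xz)
import Algebra.Properties.CommutativeSemigroup *-commutativeSemigroup as *-CS
open import Data.Product using (∃; ∃₂; Σ-syntax; _×_; _,_; proj₁; proj₂)
open import Data.Rational as ℚ using (ℚ; toℚᵘ)
import Data.Rational.Properties as ℚP
open import Data.Rational.Unnormalised as ℚᵘ using (mkℚᵘ; *≡*; *≤*)
import Data.Rational.Unnormalised.Properties as ℚᵘP
open import Data.Sum using (_⊎_; inj₁; inj₂)
open import Function using (id; _∘_)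
open import Level using (Level; 0ℓ)
open import Relation.Binary.Bundles using (Setoid)
open import Relation.Binary.Definitions using (_Respects_)
open import Relation.Binary.PropositionalEquality
  using (_≡_; _≢_; _≗_; refl; sym; trans; subst; subst₂; cong; cong₂; ≢-sym; module ≡-Reasoning)
open import Relation.Nullary using (¬_; Dec; yes; no; ¬?; contradiction)
open import Relation.Nullary.Decidable using (_×-dec_; decidable-stable)
open import Relation.Unary using (Pred; Decidable)

open import Defs

private variable a c ℓ ℓ′ p : Level

-- Counting in lists

indicator : {X : Set p} → Dec X → ℕ
indicator (yes _) = 1
indicator (no _)  = 0

module _ {A : Set a} {P : Pred A p} (P? : Decidable P) where

  count : List A → ℕ
  count xs = length (filter P? xs)

  count-∷ : ∀ x xs → count (x ∷ xs) ≡ indicator (P? x) + count xs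
  count-∷ x xs with P? x
  ... | yes _ = refl
  ... | no _  = refl

  count-─ : ∀ {Q : Pred A ℓ′} {xs} (x∈xs : Any Q xs) →
            count xs ≡ indicator (P? (Any.lookup x∈xs)) + count (xs ─ x∈xs)
  count-─ {xs = x ∷ xs} (here _) = count-∷ x xs
  count-─ {xs = x ∷ xs} (there y∈xs) = begin
    count (x ∷ xs)
      ≡⟨ count-∷ x xs ⟩
    indicator (P? x) + count xs
      ≡⟨ cong (indicator (P? x) +_) (count-─ y∈xs) ⟩
    indicator (P? x) + (indicator (P? y) + count (xs ─ y∈xs))
      ≡⟨ x∙yz≈y∙xz (indicator (P? x)) (indicator (P? y)) _ ⟩
    indicator (P? y) + (indicator (P? x) + count (xs ─ y∈xs))
      ≡⟨ cong (indicator (P? y) +_) (count-∷ x (xs ─ y∈xs)) ⟨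
    indicator (P? y) + count (x ∷ xs ─ there y∈xs)
      ∎
    where
    open ≡-Reasoning
    y : A
    y = Any.lookup y∈xs

module _ {A : Set a} {P Q R : Pred A p} (P? : Decidable P) (Q? : Decidable Q) (R? : Decidable R)
         (P⇒Q⊎R : ∀ {x} → P x → Q x ⊎ R x) where

  indicator-≤-+ : ∀ x → indicator (P? x) ≤ indicator (Q? x) + indicator (R? x)
  indicator-≤-+ x with P? x
  ... | no _   = z≤n
  ... | yes px with P⇒Q⊎R px | Q? x | R? x
  ...   | _       | yes _  | _      = s≤s z≤n
  ...   | _       | no _   | yes _  = s≤s z≤n
  ...   | inj₁ qx | no ¬qx | no _   = contradiction qx ¬qx
  ...   | inj₂ rx | no _   | no ¬rx = contradiction rx ¬rx

  count-≤-+ : ∀ xs → count P? xs ≤ count Q? xs + count R? xs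
  count-≤-+ []       = z≤n
  count-≤-+ (x ∷ xs) = begin
    count P? (x ∷ xs)                                   ≡⟨ count-∷ P? x xs ⟩
    indicator (P? x) + count P? xs                       ≤⟨ +-mono-≤ (indicator-≤-+ x) (count-≤-+ xs) ⟩
    (indicator (Q? x) + indicator (R? x)) + (count Q? xs + count R? xs)
      ≡⟨ interchange (indicator (Q? x)) (indicator (R? x)) (count Q? xs) _ ⟩
    (indicator (Q? x) + count Q? xs) + (indicator (R? x) + count R? xs)
      ≡⟨ cong₂ _+_ (count-∷ Q? x xs) (count-∷ R? x xs) ⟨
    count Q? (x ∷ xs) + count R? (x ∷ xs)               ∎
    where open ≤-Reasoning

AllPairs-─⁺ : ∀ {A : Set a} {R : A → A → Set ℓ} {P : Pred A p} {xs} (x∈xs : Any P xs) →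
              AllPairs R xs → AllPairs R (xs ─ x∈xs)
AllPairs-─⁺ (here _)     (_ ∷ rs)  = rs
AllPairs-─⁺ (there x∈xs) (r ∷ rs) = All.─⁺ x∈xs r ∷ AllPairs-─⁺ x∈xs rs

module _ (S : Setoid c ℓ) where

  open Setoid S using (_≈_) renaming (Carrier to A; refl to ≈-refl; sym to ≈-sym; trans to ≈-trans)
  open SetoidMembership S using (_∈_)
  open SetoidUnique S using (Unique)

  ∈-─⁺ : ∀ {P : Pred A p} {y xs} (x∈xs : Any P xs) → y ∈ xs → ¬ Any.lookup x∈xs ≈ y → y ∈ (xs ─ x∈xs)
  ∈-─⁺ (here _)     (here y≈x)   x≉y = contradiction (≈-sym y≈x) x≉y
  ∈-─⁺ (here _)     (there y∈xs) _   = y∈xs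
  ∈-─⁺ (there _)    (here y≈z)   _   = here y≈z
  ∈-─⁺ (there x∈xs) (there y∈xs) x≉y = there (∈-─⁺ x∈xs y∈xs x≉y)

  ∈-─⁻ : ∀ {P : Pred A p} {y xs} (x∈xs : Any P xs) → y ∈ (xs ─ x∈xs) → y ∈ xs
  ∈-─⁻ (here _)     y∈xs         = there y∈xs
  ∈-─⁻ (there _)    (here y≈z)   = here y≈z
  ∈-─⁻ (there x∈xs) (there y∈xs) = there (∈-─⁻ x∈xs y∈xs)

  length-≤-injection : ∀ (f : A → A) {xs ys} → Unique xs →
                       (∀ {x y} → x ∈ xs → y ∈ xs → f x ≈ f y → x ≈ y) →
                       (∀ {x} → x ∈ xs → f x ∈ ys) → length xs ≤ length ys
  length-≤-injection f {[]}     _            _   _   = z≤n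
  length-≤-injection f {x ∷ xs} {ys} (x≉xs ∷ xs!) inj img = begin
    suc (length xs)              ≤⟨ s≤s (length-≤-injection f xs! (λ p q → inj (there p) (there q)) img′) ⟩
    suc (length (ys ─ fx∈ys))    ≡⟨ length-removeAt′ ys (index fx∈ys) ⟨
    length ys                    ∎
    where
    open ≤-Reasoning
    fx∈ys : f x ∈ ys
    fx∈ys = img (here ≈-refl)
    fx≉fy : ∀ {y} → y ∈ xs → ¬ f x ≈ f y
    fx≉fy y∈xs fx≈fy =
      All[≉]⇒∉ S x≉xs (∈-resp-≈ S (≈-sym (inj (here ≈-refl) (there y∈xs) fx≈fy)) y∈xs)
    img′ : ∀ {y} → y ∈ xs → f y ∈ (ys ─ fx∈ys)
    img′ y∈xs =
      ∈-─⁺ fx∈ys (img (there y∈xs)) (λ fx′≈fy → fx≉fy y∈xs (≈-trans (lookup-result fx∈ys) fx′≈fy))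

-- Finite sums of naturals

δ : ∀ {m} → Fin m → Fin m → ℕ
δ i j = indicator (i Fin.≟ j)

δ-diag : ∀ {m} (i : Fin m) → δ i i ≡ 1
δ-diag i with i Fin.≟ i
... | yes _  = refl
... | no i≢i = contradiction refl i≢i

δ-≢ : ∀ {m} {i j : Fin m} → i ≢ j → δ i j ≡ 0
δ-≢ {i = i} {j} i≢j with i Fin.≟ j
... | yes i≡j = contradiction i≡j i≢j
... | no _    = refl

δ-suc : ∀ {m} (i j : Fin m) → δ (Fin.suc i) (Fin.suc j) ≡ δ i j
δ-suc i j with i Fin.≟ j
... | yes _ = refl
... | no _  = refl

sum-mono-≤ : ∀ {N} {f g : Fin N → ℕ} → (∀ i → f i ≤ g i) → sum f ≤ sum g
sum-mono-≤ {zero}  f≤g = z≤n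
sum-mono-≤ {suc N} f≤g = +-mono-≤ (f≤g zero) (sum-mono-≤ (f≤g ∘ suc))

sum-mono-< : ∀ {N} {f g : Fin N → ℕ} → (∀ i → f i ≤ g i) → ∀ j → f j < g j → sum f < sum g
sum-mono-< {suc N} f≤g zero    fⱼ<gⱼ = +-mono-<-≤ fⱼ<gⱼ (sum-mono-≤ (f≤g ∘ suc))
sum-mono-< {suc N} f≤g (suc j) fⱼ<gⱼ = +-mono-≤-< (f≤g zero) (sum-mono-< (f≤g ∘ suc) j fⱼ<gⱼ)

sum-const : ∀ N c → ∑[ i < N ] c ≡ N * c
sum-const zero    c = refl
sum-const (suc N) c = cong (c +_) (sum-const N c)

sum-zero : ∀ {N} {f : Fin N → ℕ} → (∀ w → f w ≡ 0) → sum f ≡ 0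
sum-zero {N} f≡0 = trans (sum-cong-≗ f≡0) (sum-replicate-zero N)

sum-δ : ∀ {N} (j : Fin N) → ∑[ i < N ] δ j i ≡ 1
sum-δ {suc N} zero    = cong suc (sum-replicate-zero N)
sum-δ {suc N} (suc j) = trans (sum-cong-≗ (δ-suc j)) (sum-δ j)

sum-allFin : ∀ {K} (f : Fin K → ℕ) → ListAction.sum (List.map f (allFin K)) ≡ sum f
sum-allFin {K} f = trans (cong ListAction.sum (map-tabulate id f)) (sum-tabulate f)
  where
  sum-tabulate : ∀ {K} (f : Fin K → ℕ) → ListAction.sum (tabulate f) ≡ sum f
  sum-tabulate {zero}  f = refl
  sum-tabulate {suc K} f = cong (f zero +_) (sum-tabulate (f ∘ suc))

n*[m/n]≤m : ∀ m N .{{_ : NonZero N}} → N * (m / N) ≤ m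
n*[m/n]≤m m N = subst (_≤ m) (*-comm (m / N) N) (m/n*n≤m m N)

m<n*[1+m/n] : ∀ m N .{{_ : NonZero N}} → m < N * suc (m / N)
m<n*[1+m/n] m N = begin-strict
  m                       ≡⟨ m≡m%n+[m/n]*n m N ⟩
  m % N + (m / N) * N     <⟨ +-monoˡ-< ((m / N) * N) (m%n<n m N) ⟩
  N + (m / N) * N         ≡⟨ cong (N +_) (*-comm (m / N) N) ⟩
  N + N * (m / N)         ≡⟨ *-suc N (m / N) ⟨
  N * suc (m / N)         ∎
  where open ≤-Reasoning

-- The imbalance of a sequence of naturals

∣m-n∣≡m∸n+n∸m : ∀ m n → ∣ m - n ∣ ≡ (m ∸ n) + (n ∸ m)
∣m-n∣≡m∸n+n∸m zero    zero    = refl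
∣m-n∣≡m∸n+n∸m zero    (suc n) = refl
∣m-n∣≡m∸n+n∸m (suc m) zero    = sym (+-identityʳ (suc m))
∣m-n∣≡m∸n+n∸m (suc m) (suc n) = ∣m-n∣≡m∸n+n∸m m n

m∸n+n≡n∸m+m : ∀ m n → (m ∸ n) + n ≡ (n ∸ m) + m
m∸n+n≡n∸m+m zero    zero    = refl
m∸n+n≡n∸m+m zero    (suc n) = sym (+-identityʳ (suc n))
m∸n+n≡n∸m+m (suc m) zero    = +-identityʳ (suc m)
m∸n+n≡n∸m+m (suc m) (suc n) = trans (+-suc (m ∸ n) n) (trans (cong suc (m∸n+n≡n∸m+m m n)) (sym (+-suc (n ∸ m) m)))

∑-∸-symmetric : ∀ {N} (f : Fin N → ℕ) m → sum f ≡ N * m → ∑[ w < N ] (f w ∸ m) ≡ ∑[ w < N ] (m ∸ f w)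
∑-∸-symmetric {N} f m ∑f≡Nm = +-cancelʳ-≡ (N * m) _ _ (begin
  ∑[ w < N ] (f w ∸ m) + N * m              ≡⟨ cong (∑[ w < N ] (f w ∸ m) +_) (sum-const N m) ⟨
  ∑[ w < N ] (f w ∸ m) + ∑[ w < N ] m       ≡⟨ ∑-distrib-+ (λ w → f w ∸ m) (λ _ → m) ⟨
  ∑[ w < N ] ((f w ∸ m) + m)                ≡⟨ sum-cong-≗ (λ w → m∸n+n≡n∸m+m (f w) m) ⟩
  ∑[ w < N ] ((m ∸ f w) + f w)              ≡⟨ ∑-distrib-+ (λ w → m ∸ f w) f ⟩
  ∑[ w < N ] (m ∸ f w) + sum f              ≡⟨ cong (∑[ w < N ] (m ∸ f w) +_) ∑f≡Nm ⟩
  ∑[ w < N ] (m ∸ f w) + N * m              ∎)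
  where open ≡-Reasoning

excess deficit imbalance : ∀ {N} → ℕ → (Fin N → ℕ) → ℕ
excess  {N} q d = ∑[ w < N ] (d w ∸ suc q)
deficit {N} q d = ∑[ w < N ] (q ∸ d w)
imbalance q d = excess q d ⊔ deficit q d

imbalance-bound : ∀ {N} q (d : Fin N → ℕ) m → sum d ≡ m → N * q ≤ m → m < N * suc q →
                  N * (2 * imbalance q d) ≤ ∑[ w < N ] ∣ N * d w - m ∣
imbalance-bound {N} q d m ∑d≡m Nq≤m m<N[1+q] = begin
  N * (2 * imbalance q d)  ≡⟨ *-CS.x∙yz≈y∙xz N 2 (imbalance q d) ⟩
  2 * (N * imbalance q d)  ≤⟨ *-monoʳ-≤ 2 N*imbalance≤above ⟩
  2 * above                ≡⟨ cong (above +_) (trans (+-identityʳ above) above≡below) ⟩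
  above + below            ≡⟨ ∑-distrib-+ (λ w → N * d w ∸ m) (λ w → m ∸ N * d w) ⟨
  ∑[ w < N ] ((N * d w ∸ m) + (m ∸ N * d w)) ≡⟨ sum-cong-≗ (λ w → ∣m-n∣≡m∸n+n∸m (N * d w) m) ⟨
  ∑[ w < N ] ∣ N * d w - m ∣ ∎
  where
  open ≤-Reasoning
  above below : ℕ
  above = ∑[ w < N ] (N * d w ∸ m)
  below = ∑[ w < N ] (m ∸ N * d w)
  above≡below : above ≡ below
  above≡below = ∑-∸-symmetric (λ w → N * d w) m (trans (sym (*-distribˡ-sum N d)) (cong (N *_) ∑d≡m))
  N*excess≤above : N * excess q d ≤ above
  N*excess≤above = ≤-trans (≤-reflexive (*-distribˡ-sum N (λ w → d w ∸ suc q))) (sum-mono-≤ λ w →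
    ≤-trans (≤-reflexive (*-distribˡ-∸ N (d w) (suc q))) (∸-monoʳ-≤ (N * d w) (<⇒≤ m<N[1+q])))
  N*deficit≤below : N * deficit q d ≤ below
  N*deficit≤below = ≤-trans (≤-reflexive (*-distribˡ-sum N (λ w → q ∸ d w))) (sum-mono-≤ λ w →
    ≤-trans (≤-reflexive (*-distribˡ-∸ N q (d w))) (∸-monoˡ-≤ (N * d w) Nq≤m))
  N*imbalance≤above : N * imbalance q d ≤ above
  N*imbalance≤above = ≤-trans (≤-reflexive (*-distribˡ-⊔ N (excess q d) (deficit q d)))
    (⊔-lub N*excess≤above (≤-trans N*deficit≤below (≤-reflexive (sym above≡below))))

imbalance-cong : ∀ {N} q {d d′ : Fin N → ℕ} → d ≗ d′ → imbalance q d ≡ imbalance q d′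
imbalance-cong q d≗d′ = cong₂ _⊔_ (sum-cong-≗ (λ w → cong (_∸ suc q) (d≗d′ w)))
                                  (sum-cong-≗ (λ w → cong (q ∸_) (d≗d′ w)))

in-window⇒∣-∣≤1 : ∀ {q x y} → q ≤ x × x ≤ suc q → q ≤ y × y ≤ suc q → ∣ x - y ∣ ≤ 1
in-window⇒∣-∣≤1 {q} {x} {y} (q≤x , x≤1+q) (q≤y , y≤1+q) with ∣m-n∣≡[m∸n]∨[n∸m] x y
... | inj₁ eq = subst (_≤ 1) (sym eq) (subst (x ∸ y ≤_) (m+n∸n≡m 1 q) (∸-mono x≤1+q q≤y))
... | inj₂ eq = subst (_≤ 1) (sym eq) (subst (y ∸ x ≤_) (m+n∸n≡m 1 q) (∸-mono y≤1+q q≤x))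

data Transfer {N : ℕ} (q : ℕ) (d : Fin N → ℕ) (u v : Fin N) : Set where
  both         : suc q < d u → d v < q → Transfer q d u v
  excess-only  : suc q < d u → d v ≤ q → deficit q d ≡ 0 → Transfer q d u v
  deficit-only : q < d u → d v < q → excess q d ≡ 0 → Transfer q d u v

module _ {N q : ℕ} {d : Fin N → ℕ} {u v : Fin N} where

  Transfer-source : Transfer q d u v → q < d u
  Transfer-source (both 1+q<dᵤ _)           = <⇒≤ 1+q<dᵤ
  Transfer-source (excess-only 1+q<dᵤ _ _)  = <⇒≤ 1+q<dᵤ
  Transfer-source (deficit-only q<dᵤ _ _)   = q<dᵤ

  Transfer-target : Transfer q d u v → d v ≤ q
  Transfer-target (both _ dᵥ<q)            = <⇒≤ dᵥ<q
  Transfer-target (excess-only _ dᵥ≤q _)   = dᵥ≤q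
  Transfer-target (deficit-only _ dᵥ<q _)  = <⇒≤ dᵥ<q

in-window-or-transfer : ∀ {N} q (d : Fin N → ℕ) → N * q ≤ sum d → sum d < N * suc q →
                        (∀ w → q ≤ d w × d w ≤ suc q) ⊎ ∃₂ (Transfer q d)
in-window-or-transfer {N} q d Nq≤∑d ∑d<N[1+q]
  with Fin.any? (λ w → suc q <? d w) | Fin.any? (λ w → d w <? q)
... | yes (u , 1+q<dᵤ) | yes (v , dᵥ<q) = inj₂ (u , v , both 1+q<dᵤ dᵥ<q)
... | yes (u , 1+q<dᵤ) | no ¬low        = inj₂ (u , proj₁ at-most-q , excess-only 1+q<dᵤ (proj₂ at-most-q)
                                                  (sum-zero λ w → m≤n⇒m∸n≡0 (≮⇒≥ (¬low ∘ (w ,_)))))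
  where
  at-most-q : ∃ λ v → d v ≤ q
  at-most-q with Fin.any? (λ w → d w ≤? q)
  ... | yes found = found
  ... | no ¬found = contradiction (begin
    N * suc q             ≡⟨ sum-const N (suc q) ⟨
    ∑[ w < N ] suc q      ≤⟨ sum-mono-≤ (λ w → ≰⇒> (¬found ∘ (w ,_))) ⟩
    sum d                 ∎) (<⇒≱ ∑d<N[1+q])
    where open ≤-Reasoning
... | no ¬high | yes (v , dᵥ<q) = inj₂ (proj₁ above-q , v , deficit-only (proj₂ above-q) dᵥ<q
                                                  (sum-zero λ w → m≤n⇒m∸n≡0 (≮⇒≥ (¬high ∘ (w ,_)))))
  where
  above-q : ∃ λ u → q < d u
  above-q with Fin.any? (λ w → q <? d w)
  ... | yes found = found
  ... | no ¬found = contradiction (begin-strict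
    sum d                 <⟨ sum-mono-< (λ w → ≮⇒≥ (¬found ∘ (w ,_))) v dᵥ<q ⟩
    ∑[ w < N ] q          ≡⟨ sum-const N q ⟩
    N * q                 ∎) (≤⇒≯ Nq≤∑d)
    where open ≤-Reasoning
... | no ¬high | no ¬low = inj₁ λ w → ≮⇒≥ (¬low ∘ (w ,_)) , ≮⇒≥ (¬high ∘ (w ,_))

module _ {N q : ℕ} {d d′ : Fin N → ℕ} {u v : Fin N} (q<dᵤ : q < d u) (dᵥ≤q : d v ≤ q)
         (moved : ∀ w → d′ w + δ u w ≡ d w + δ v w) where

  private
    u≢v : u ≢ v
    u≢v refl = <⇒≱ q<dᵤ dᵥ≤q

    d′ᵤ : suc (d′ u) ≡ d u
    d′ᵤ = begin
      suc (d′ u)      ≡⟨ +-comm 1 (d′ u) ⟩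
      d′ u + 1        ≡⟨ cong (d′ u +_) (δ-diag u) ⟨
      d′ u + δ u u    ≡⟨ moved u ⟩
      d u + δ v u     ≡⟨ cong (d u +_) (δ-≢ (u≢v ∘ sym)) ⟩
      d u + 0         ≡⟨ +-identityʳ (d u) ⟩
      d u             ∎
      where open ≡-Reasoning

    d′ᵥ : d′ v ≡ suc (d v)
    d′ᵥ = begin
      d′ v            ≡⟨ +-identityʳ (d′ v) ⟨
      d′ v + 0        ≡⟨ cong (d′ v +_) (δ-≢ u≢v) ⟨
      d′ v + δ u v    ≡⟨ moved v ⟩
      d v + δ v v     ≡⟨ cong (d v +_) (δ-diag v) ⟩
      d v + 1         ≡⟨ +-comm (d v) 1 ⟩
      suc (d v)       ∎
      where open ≡-Reasoning

    d′≤d : ∀ {w} → w ≢ v → d′ w ≤ d w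
    d′≤d {w} w≢v = ≤-trans (m≤m+n (d′ w) (δ u w))
      (≤-reflexive (trans (moved w) (trans (cong (d w +_) (δ-≢ (w≢v ∘ sym))) (+-identityʳ (d w)))))

    d≤d′ : ∀ {w} → w ≢ u → d w ≤ d′ w
    d≤d′ {w} w≢u = ≤-trans (m≤m+n (d w) (δ v w))
      (≤-reflexive (trans (sym (moved w)) (trans (cong (d′ w +_) (δ-≢ (w≢u ∘ sym))) (+-identityʳ (d′ w)))))

    excess-term : ∀ w → d′ w ∸ suc q ≤ d w ∸ suc q
    excess-term w with w Fin.≟ v
    ... | yes refl = ≤-trans (≤-reflexive (m≤n⇒m∸n≡0 (≤-trans (≤-reflexive d′ᵥ) (s≤s dᵥ≤q)))) z≤n
    ... | no w≢v   = ∸-monoˡ-≤ (suc q) (d′≤d w≢v)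

    deficit-term : ∀ w → q ∸ d′ w ≤ q ∸ d w
    deficit-term w with w Fin.≟ u
    ... | yes refl = ≤-trans (≤-reflexive (m≤n⇒m∸n≡0 (≤-pred (≤-trans q<dᵤ (≤-reflexive (sym d′ᵤ)))))) z≤n
    ... | no w≢u   = ∸-monoʳ-≤ q (d≤d′ w≢u)

    excess-≤ : excess q d′ ≤ excess q d
    excess-≤ = sum-mono-≤ excess-term

    deficit-≤ : deficit q d′ ≤ deficit q d
    deficit-≤ = sum-mono-≤ deficit-term

    excess-< : suc q < d u → excess q d′ < excess q d
    excess-< 1+q<dᵤ = sum-mono-< excess-term u
      (∸-monoˡ-< (≤-reflexive d′ᵤ) (≤-pred (≤-trans 1+q<dᵤ (≤-reflexive (sym d′ᵤ)))))

    deficit-< : d v < q → deficit q d′ < deficit q d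
    deficit-< dᵥ<q = sum-mono-< deficit-term v
      (∸-monoʳ-< (≤-reflexive (sym d′ᵥ)) (≤-trans (≤-reflexive d′ᵥ) dᵥ<q))

  imbalance-decreases : Transfer q d u v → imbalance q d′ < imbalance q d
  imbalance-decreases (both 1+q<dᵤ dᵥ<q) = ⊔-mono-< (excess-< 1+q<dᵤ) (deficit-< dᵥ<q)
  imbalance-decreases (excess-only 1+q<dᵤ _ deficit≡0) = begin-strict
    excess q d′ ⊔ deficit q d′
      ≡⟨ cong (excess q d′ ⊔_) (n≤0⇒n≡0 (≤-trans deficit-≤ (≤-reflexive deficit≡0))) ⟩
    excess q d′ ⊔ 0             ≡⟨ ⊔-identityʳ (excess q d′) ⟩
    excess q d′                 <⟨ excess-< 1+q<dᵤ ⟩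
    excess q d                  ≤⟨ m≤m⊔n (excess q d) (deficit q d) ⟩
    imbalance q d               ∎
    where open ≤-Reasoning
  imbalance-decreases (deficit-only _ dᵥ<q excess≡0) = begin-strict
    excess q d′ ⊔ deficit q d′
      ≡⟨ cong (_⊔ deficit q d′) (n≤0⇒n≡0 (≤-trans excess-≤ (≤-reflexive excess≡0))) ⟩
    deficit q d′                <⟨ deficit-< dᵥ<q ⟩
    deficit q d                 ≤⟨ m≤n⊔m (excess q d) (deficit q d) ⟩
    imbalance q d               ∎
    where open ≤-Reasoning

-- Symmetric differences and moving one edge

module _ {r : ℕ} {n : Fin r → ℕ} where

  -- Membership and Unique over this setoid unfold to _∈E_ and the field distinct of Defs.
  Edge-setoid : Setoid 0ℓ 0ℓ
  Edge-setoid = record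
    { Carrier       = Edge r n
    ; _≈_           = _≈E_
    ; isEquivalence = record
      { refl  = λ _ → refl
      ; sym   = λ e≈f i → sym (e≈f i)
      ; trans = λ e≈f f≈g i → trans (e≈f i) (f≈g i)
      }
    }

  open Setoid Edge-setoid using () renaming (sym to ≈E-sym)
  open SetoidMembership Edge-setoid using (_∈_; _∉_)

  private
    _∉?_ : (e : Edge r n) (G : Hypergraph r n) → Dec (e ∉ edges G)
    e ∉? G = ¬? (e ∈E? G)

  through? : ∀ k w → Decidable (λ (e : Edge r n) → e k ≡ w)
  through? k w e = e k Fin.≟ w

  through-resp : ∀ k w → (λ (e : Edge r n) → e k ≡ w) Respects _≈E_
  through-resp k w e≈f eₖ≡w = trans (sym (e≈f k)) eₖ≡w

  diffSize-self : ∀ G → diffSize G G ≡ 0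
  diffSize-self G =
    cong length (filter-none (_∉? G) {edges G} (All.tabulateₛ Edge-setoid λ e∈G e∉G → e∉G e∈G))

  diffSize-≤-1 : ∀ G H e → (∀ {f} → f ∈ edges G → f ∉ edges H → f ≈E e) → diffSize G H ≤ 1
  diffSize-≤-1 G H e only-e =
    length-≤-injection Edge-setoid id {ys = [ e ]} (Unique.filter⁺ Edge-setoid (_∉? H) (distinct G))
      (λ _ _ f≈g → f≈g)
      (λ f∈ → let f∈G , f∉H = ∈-filter⁻ Edge-setoid (_∉? H) (∉-resp-≈ Edge-setoid) f∈ in here (only-e f∈G f∉H))

  diffSize-triangle : ∀ A B C → diffSize A C ≤ diffSize A B + diffSize B C
  diffSize-triangle A B C = begin
    diffSize A C                ≤⟨ count-≤-+ (_∉? C) (_∉? B) in-B-not-C? split (edges A) ⟩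
    diffSize A B + count in-B-not-C? (edges A)
      ≤⟨ +-monoʳ-≤ (diffSize A B) (length-≤-injection Edge-setoid id
           (Unique.filter⁺ Edge-setoid in-B-not-C? (distinct A)) (λ _ _ e≈f → e≈f) img) ⟩
    diffSize A B + diffSize B C ∎
    where
    open ≤-Reasoning
    in-B-not-C? : Decidable (λ e → e ∈ edges B × e ∉ edges C)
    in-B-not-C? e = (e ∈E? B) ×-dec (e ∉? C)
    split : ∀ {e} → e ∉ edges C → e ∉ edges B ⊎ (e ∈ edges B × e ∉ edges C)
    split {e} e∉C with e ∈E? B
    ... | yes e∈B = inj₂ (e∈B , e∉C)
    ... | no e∉B  = inj₁ e∉B
    in-B-not-C-resp : (λ e → e ∈ edges B × e ∉ edges C) Respects _≈E_
    in-B-not-C-resp e≈f (e∈B , e∉C) = ∈-resp-≈ Edge-setoid e≈f e∈B , ∉-resp-≈ Edge-setoid e≈f e∉C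
    img : ∀ {e} → e ∈ filter in-B-not-C? (edges A) → e ∈ filter (_∉? C) (edges B)
    img e∈ = let _ , e∈B , e∉C = ∈-filter⁻ Edge-setoid in-B-not-C? in-B-not-C-resp {xs = edges A} e∈
             in ∈-filter⁺ Edge-setoid (_∉? C) (∉-resp-≈ Edge-setoid) e∈B e∉C

  symDiffSize-self : ∀ G → symDiffSize G G ≡ 0
  symDiffSize-self G = cong₂ _+_ (diffSize-self G) (diffSize-self G)

  symDiffSize-triangle : ∀ A B C → symDiffSize A C ≤ symDiffSize A B + symDiffSize B C
  symDiffSize-triangle A B C = begin
    diffSize A C + diffSize C A
      ≤⟨ +-mono-≤ (diffSize-triangle A B C) (diffSize-triangle C B A) ⟩
    (diffSize A B + diffSize B C) + (diffSize C B + diffSize B A)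
      ≡⟨ cong ((diffSize A B + diffSize B C) +_) (+-comm (diffSize C B) _) ⟩
    (diffSize A B + diffSize B C) + (diffSize B A + diffSize C B)
      ≡⟨ interchange (diffSize A B) (diffSize B C) (diffSize B A) _ ⟩
    symDiffSize A B + symDiffSize B C ∎
    where open ≤-Reasoning

  _[_]≔_ : Edge r n → (k : Fin r) → Fin (n k) → Edge r n
  (e [ k ]≔ v) i with i Fin.≟ k
  ... | yes refl = v
  ... | no _     = e i

  []≔-updated : ∀ e k v → (e [ k ]≔ v) k ≡ v
  []≔-updated e k v with k Fin.≟ k
  ... | yes refl = refl
  ... | no k≢k   = contradiction refl k≢k

  []≔-untouched : ∀ e {k i} v → i ≢ k → (e [ k ]≔ v) i ≡ e i
  []≔-untouched e {k} {i} v i≢k with i Fin.≟ k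
  ... | yes i≡k = contradiction i≡k i≢k
  ... | no _    = refl

  []≔-cong : ∀ {e f} k v → e ≈E f → (e [ k ]≔ v) ≈E (f [ k ]≔ v)
  []≔-cong k v e≈f i with i Fin.≟ k
  ... | yes refl = refl
  ... | no _     = e≈f i

  []≔-injective : ∀ {e f k} v → e k ≡ f k → (e [ k ]≔ v) ≈E (f [ k ]≔ v) → e ≈E f
  []≔-injective {e} {f} {k} v eₖ≡fₖ e′≈f′ i with i Fin.≟ k
  ... | yes refl = eₖ≡fₖ
  ... | no i≢k   = trans (sym ([]≔-untouched e v i≢k)) (trans (e′≈f′ i) ([]≔-untouched f v i≢k))

  record Edit (G : Hypergraph r n) (k : Fin r) (c : ℕ) : Set where
    field
      graph     : Hypergraph r n
      elsewhere : ∀ {k′} → k′ ≢ k → deg graph k′ ≗ deg G k′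
      size      : numEdges graph ≡ numEdges G
      cost      : symDiffSize G graph ≤ c

  open Edit public

  Edit-refl : ∀ G k → Edit G k 0
  Edit-refl G k = record
    { graph = G ; elsewhere = λ _ _ → refl ; size = refl ; cost = ≤-reflexive (symDiffSize-self G) }

  Edit-trans : ∀ {G k a b} (E : Edit G k a) → Edit (graph E) k b → Edit G k (a + b)
  Edit-trans {G} E F = record
    { graph     = graph F
    ; elsewhere = λ k′≢k w → trans (elsewhere F k′≢k w) (elsewhere E k′≢k w)
    ; size      = trans (size F) (size E)
    ; cost      = ≤-trans (symDiffSize-triangle G (graph E) (graph F)) (+-mono-≤ (cost E) (cost F))
    }

  Edit-weaken : ∀ {G k a b} → a ≤ b → Edit G k a → Edit G k b
  Edit-weaken a≤b E = record
    { graph = graph E ; elsewhere = elsewhere E ; size = size E ; cost = ≤-trans (cost E) a≤b }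

  module Exchange (G : Hypergraph r n) {P : Pred (Edge r n) 0ℓ} (x∈G : Any P (edges G))
                  (y : Edge r n) (y∉G : y ∉ edges G) where

    x : Edge r n
    x = Any.lookup x∈G

    exchanged : Hypergraph r n
    exchanged = record
      { edges    = y ∷ (edges G ─ x∈G)
      ; distinct = All.─⁺ x∈G (All.¬Any⇒All¬ (edges G) y∉G) ∷ AllPairs-─⁺ x∈G (distinct G)
      }

    deg-exchanged : ∀ k w → deg exchanged k w + δ (x k) w ≡ deg G k w + δ (y k) w
    deg-exchanged k w = begin
      deg exchanged k w + δ (x k) w                  ≡⟨ cong (_+ δ (x k) w) (count-∷ (through? k w) y rest) ⟩
      (δ (y k) w + count (through? k w) rest) + δ (x k) w
        ≡⟨ xy∙z≈zy∙x (δ (y k) w) (count (through? k w) rest) _ ⟩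
      (δ (x k) w + count (through? k w) rest) + δ (y k) w
        ≡⟨ cong (_+ δ (y k) w) (count-─ (through? k w) x∈G) ⟨
      deg G k w + δ (y k) w                          ∎
      where
      open ≡-Reasoning
      rest : List (Edge r n)
      rest = edges G ─ x∈G

    numEdges-exchanged : numEdges exchanged ≡ numEdges G
    numEdges-exchanged = sym (length-removeAt′ (edges G) (index x∈G))

    symDiffSize-exchanged : symDiffSize G exchanged ≤ 2
    symDiffSize-exchanged = +-mono-≤ (diffSize-≤-1 G exchanged x removed) (diffSize-≤-1 exchanged G y added)
      where
      removed : ∀ {e} → e ∈ edges G → e ∉ edges exchanged → e ≈E x
      removed {e} e∈G e∉G′ with x ≈E? e
      ... | yes x≈e = ≈E-sym x≈e
      ... | no x≉e  = contradiction (there (∈-─⁺ Edge-setoid x∈G e∈G x≉e)) e∉G′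
      added : ∀ {e} → e ∈ edges exchanged → e ∉ edges G → e ≈E y
      added (here e≈y)  _   = e≈y
      added (there e∈G′) e∉G = contradiction (∈-─⁻ Edge-setoid x∈G e∈G′) e∉G

  deg-≤-shift : ∀ G k {u v} → (∀ {e} → e ∈ edges G → e k ≡ u → (e [ k ]≔ v) ∈ edges G) →
                deg G k u ≤ deg G k v
  deg-≤-shift G k {u} {v} closed =
    length-≤-injection Edge-setoid (_[ k ]≔ v) (Unique.filter⁺ Edge-setoid (through? k u) (distinct G)) inj img
    where
    through : ∀ w {e} → e ∈ filter (through? k w) (edges G) → e ∈ edges G × e k ≡ w
    through w = ∈-filter⁻ Edge-setoid (through? k w) (through-resp k w) {xs = edges G}
    inj : ∀ {e f} → e ∈ filter (through? k u) (edges G) → f ∈ filter (through? k u) (edges G) →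
          (e [ k ]≔ v) ≈E (f [ k ]≔ v) → e ≈E f
    inj e∈ f∈ = []≔-injective v (trans (proj₂ (through u e∈)) (sym (proj₂ (through u f∈))))
    img : ∀ {e} → e ∈ filter (through? k u) (edges G) → (e [ k ]≔ v) ∈ filter (through? k v) (edges G)
    img {e} e∈ = let e∈G , eₖ≡u = through u e∈ in
      ∈-filter⁺ Edge-setoid (through? k v) (through-resp k v) (closed e∈G eₖ≡u) ([]≔-updated e k v)

  shift : ∀ G k {u v} → deg G k v < deg G k u →
          Σ[ E ∈ Edit G k 2 ] (∀ w → deg (graph E) k w + δ u w ≡ deg G k w + δ v w)
  shift G k {u} {v} v<u with Any.any? (λ e → through? k u e ×-dec ¬? ((e [ k ]≔ v) ∈E? G)) (edges G)
  ... | no ¬movable = contradiction (deg-≤-shift G k closed) (<⇒≱ v<u)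
    where
    movable-resp : (λ e → e k ≡ u × (e [ k ]≔ v) ∉ edges G) Respects _≈E_
    movable-resp e≈f (eₖ≡u , e′∉G) =
      through-resp k u e≈f eₖ≡u , ∉-resp-≈ Edge-setoid ([]≔-cong k v e≈f) e′∉G
    closed : ∀ {e} → e ∈ edges G → e k ≡ u → (e [ k ]≔ v) ∈ edges G
    closed e∈G eₖ≡u =
      decidable-stable (_ ∈E? G) λ e′∉G → ¬movable (lose Edge-setoid movable-resp e∈G (eₖ≡u , e′∉G))
  ... | yes movable = edit , deg-class
    where
    x : Edge r n
    x = Any.lookup movable
    xₖ≡u : x k ≡ u
    xₖ≡u = proj₁ (lookup-result movable)
    open Exchange G movable (x [ k ]≔ v) (proj₂ (lookup-result movable)) hiding (x)
    edit : Edit G k 2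
    edit = record
      { graph     = exchanged
      ; elsewhere = λ {k′} k′≢k w → +-cancelʳ-≡ (δ (x k′) w) _ _ (begin
          deg exchanged k′ w + δ (x k′) w    ≡⟨ deg-exchanged k′ w ⟩
          deg G k′ w + δ ((x [ k ]≔ v) k′) w ≡⟨ cong (λ i → deg G k′ w + δ i w) ([]≔-untouched x v k′≢k) ⟩
          deg G k′ w + δ (x k′) w            ∎)
      ; size      = numEdges-exchanged
      ; cost      = symDiffSize-exchanged
      }
      where open ≡-Reasoning
    deg-class : ∀ w → deg exchanged k w + δ u w ≡ deg G k w + δ v w
    deg-class w = begin
      deg exchanged k w + δ u w            ≡⟨ cong (λ i → deg exchanged k w + δ i w) xₖ≡u ⟨
      deg exchanged k w + δ (x k) w        ≡⟨ deg-exchanged k w ⟩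
      deg G k w + δ ((x [ k ]≔ v) k) w     ≡⟨ cong (λ i → deg G k w + δ i w) ([]≔-updated x k v) ⟩
      deg G k w + δ v w                    ∎
      where open ≡-Reasoning

  deg-sum : ∀ (G : Hypergraph r n) k → ∑[ w < n k ] deg G k w ≡ numEdges G
  deg-sum G k = handshake (edges G)
    where
    handshake : ∀ es → ∑[ w < n k ] count (through? k w) es ≡ length es
    handshake []       = sum-replicate-zero (n k)
    handshake (e ∷ es) = begin
      ∑[ w < n k ] count (through? k w) (e ∷ es)   ≡⟨ sum-cong-≗ (λ w → count-∷ (through? k w) e es) ⟩
      ∑[ w < n k ] (δ (e k) w + count (through? k w) es)
        ≡⟨ ∑-distrib-+ (δ (e k)) _ ⟩
      ∑[ w < n k ] δ (e k) w + ∑[ w < n k ] count (through? k w) es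
        ≡⟨ cong₂ _+_ (sum-δ (e k)) (handshake es) ⟩
      suc (length es)                              ∎
      where open ≡-Reasoning

  Balanced : Hypergraph r n → Fin r → Set
  Balanced G k = ∀ a b → ∣ deg G k a - deg G k b ∣ ≤ 1

  balance-class : ∀ fuel G k q → n k * q ≤ numEdges G → numEdges G < n k * suc q →
                  imbalance q (deg G k) ≤ fuel →
                  Σ[ E ∈ Edit G k (2 * imbalance q (deg G k)) ] Balanced (graph E) k
  balance-class fuel G k q lower upper bounded
    with in-window-or-transfer q (deg G k) (subst (n k * q ≤_) (sym (deg-sum G k)) lower)
                                           (subst (_< n k * suc q) (sym (deg-sum G k)) upper)
  ... | inj₁ in-window =
    Edit-weaken z≤n (Edit-refl G k) ,
    λ a b → in-window⇒∣-∣≤1 (in-window a) (in-window b)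
  ... | inj₂ (u , v , transfer) with shift G k (≤-<-trans (Transfer-target transfer) (Transfer-source transfer))
  ...   | E , moved = continue fuel bounded
    where
    decreased : imbalance q (deg (graph E) k) < imbalance q (deg G k)
    decreased = imbalance-decreases (Transfer-source transfer) (Transfer-target transfer) moved transfer
    continue : ∀ fuel → imbalance q (deg G k) ≤ fuel →
               Σ[ E ∈ Edit G k (2 * imbalance q (deg G k)) ] Balanced (graph E) k
    continue zero       bounded = contradiction (≤-trans decreased bounded) λ ()
    continue (suc fuel) bounded =
      let F , balanced = balance-class fuel (graph E) k q
                           (subst (n k * q ≤_) (sym (size E)) lower) (subst (_< n k * suc q) (sym (size E)) upper)
                           (≤-pred (≤-trans decreased bounded))
      in Edit-weaken (≤-trans (≤-reflexive (sym (*-suc 2 _))) (*-monoʳ-≤ 2 decreased)) (Edit-trans E F) , balanced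

  Balanced-resp : ∀ {G G′ : Hypergraph r n} {k} → deg G k ≗ deg G′ k → Balanced G k → Balanced G′ k
  Balanced-resp same balanced a b = subst₂ (λ x y → ∣ x - y ∣ ≤ 1) (same a) (same b) (balanced a b)

-- Rational bounds

-- Opened only here: in scope above, +_ would make the sections (m +_) of ℕ ambiguous.
open import Data.Integer using (+_)

∣+m-+n∣≡∣m-n∣ : ∀ m n → ℤ.∣ + m ℤ.- + n ∣ ≡ ∣ m - n ∣
∣+m-+n∣≡∣m-n∣ m n with ≤-total m n
... | inj₁ m≤n = trans (cong ℤ.∣_∣ (ℤP.m-n≡m⊖n m n)) (trans (ℤP.∣⊖∣-≤ m≤n) (sym (m≤n⇒∣m-n∣≡n∸m m≤n)))
... | inj₂ n≤m = trans (cong ℤ.∣_∣ (ℤP.m-n≡m⊖n m n))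
                   (trans (ℤP.∣m⊖n∣≡∣n⊖m∣ m n) (trans (ℤP.∣⊖∣-≤ n≤m) (sym (m≤n⇒∣n-m∣≡n∸m n≤m))))

toℚᵘ-/ : ∀ i N .{{_ : NonZero N}} → toℚᵘ (i ℚ./ N) ℚᵘ.≃ mkℚᵘ i (pred N)
toℚᵘ-/ i (suc N) = ℚP.toℚᵘ-fromℚᵘ (mkℚᵘ i N)

n*a≤b⇒a/1≤b/n : ∀ {a b} N .{{_ : NonZero N}} → N * a ≤ b → + a ℚ./ 1 ℚ.≤ + b ℚ./ N
n*a≤b⇒a/1≤b/n {a} {b} N@(suc _) Na≤b =
  ℚP.toℚᵘ-cancel-≤ (ℚᵘP.≤-respˡ-≃ (ℚᵘP.≃-sym (toℚᵘ-/ (+ a) 1))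
    (ℚᵘP.≤-respʳ-≃ (ℚᵘP.≃-sym (toℚᵘ-/ (+ b) N))
    (*≤* (subst₂ ℤ._≤_ (ℤP.pos-* a N) (ℤP.pos-* b 1)
      (ℤ.+≤+ (≤-trans (≤-reflexive (*-comm a N)) (≤-trans Na≤b (≤-reflexive (sym (*-identityʳ b))))))))))

a/n+b/n≡[a+b]/n : ∀ a b N .{{_ : NonZero N}} → + a ℚ./ N ℚ.+ + b ℚ./ N ≡ + (a + b) ℚ./ N
a/n+b/n≡[a+b]/n a b N@(suc _) = ℚP.toℚᵘ-injective (begin
  toℚᵘ (+ a ℚ./ N ℚ.+ + b ℚ./ N)                 ≈⟨ ℚP.toℚᵘ-homo-+ (+ a ℚ./ N) (+ b ℚ./ N) ⟩
  toℚᵘ (+ a ℚ./ N) ℚᵘ.+ toℚᵘ (+ b ℚ./ N)         ≈⟨ ℚᵘP.+-cong (toℚᵘ-/ (+ a) N) (toℚᵘ-/ (+ b) N) ⟩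
  mkℚᵘ (+ a) (pred N) ℚᵘ.+ mkℚᵘ (+ b) (pred N)   ≈⟨ *≡* (common-denominator (+ a) (+ b) (+ N)) ⟩
  mkℚᵘ (+ (a + b)) (pred N)                      ≈⟨ toℚᵘ-/ (+ (a + b)) N ⟨
  toℚᵘ (+ (a + b) ℚ./ N)                         ∎)
  where
  open ℚᵘP.≃-Reasoning
  common-denominator : ∀ (i j k : ℤ) → (i ℤ.* k ℤ.+ j ℤ.* k) ℤ.* k ≡ (i ℤ.+ j) ℤ.* (k ℤ.* k)
  common-denominator = solve-∀

∣d/1-m/n∣≡∣n*d-m∣/n : ∀ d m N .{{_ : NonZero N}} →
                      ℚ.∣ + d ℚ./ 1 ℚ.- + m ℚ./ N ∣ ≡ + ∣ N * d - m ∣ ℚ./ N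
∣d/1-m/n∣≡∣n*d-m∣/n d m N@(suc N-1) = ℚP.toℚᵘ-injective (begin
  toℚᵘ ℚ.∣ x ℚ.- y ∣                                ≈⟨ ℚP.toℚᵘ-homo-∣-∣ (x ℚ.- y) ⟩
  ℚᵘ.∣ toℚᵘ (x ℚ.- y) ∣                             ≈⟨ ℚᵘP.∣-∣-cong (ℚP.toℚᵘ-homo-+ x (ℚ.- y)) ⟩
  ℚᵘ.∣ toℚᵘ x ℚᵘ.+ toℚᵘ (ℚ.- y) ∣                   ≈⟨ ℚᵘP.∣-∣-cong (ℚᵘP.+-cong (toℚᵘ-/ (+ d) 1)
                                                         (ℚᵘP.≃-trans (ℚP.toℚᵘ-homo‿- y) (ℚᵘP.-‿cong (toℚᵘ-/ (+ m) N)))) ⟩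
  ℚᵘ.∣ mkℚᵘ (+ d) 0 ℚᵘ.+ ℚᵘ.- mkℚᵘ (+ m) N-1 ∣       ≈⟨ *≡* (cong₂ ℤ._*_ numerator (sym denominator)) ⟩
  mkℚᵘ (+ ∣ N * d - m ∣) N-1                        ≈⟨ toℚᵘ-/ (+ ∣ N * d - m ∣) N ⟨
  toℚᵘ (+ ∣ N * d - m ∣ ℚ./ N)                       ∎)
  where
  open ℚᵘP.≃-Reasoning
  x y : ℚ
  x = + d ℚ./ 1
  y = + m ℚ./ N
  difference : ℚᵘ.ℚᵘ
  difference = ℚᵘ.∣ mkℚᵘ (+ d) 0 ℚᵘ.+ ℚᵘ.- mkℚᵘ (+ m) N-1 ∣
  numerator : ℚᵘ.↥ difference ≡ + ∣ N * d - m ∣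
  numerator = cong +_ (trans (cong₂ (λ i j → ℤ.∣ i ℤ.+ j ∣) (sym (ℤP.pos-* d N)) (ℤP.*-identityʳ (ℤ.- + m)))
                             (trans (∣+m-+n∣≡∣m-n∣ (d * N) m) (cong (∣_- m ∣) (*-comm d N))))
  denominator : ℚᵘ.↧ difference ≡ + N
  denominator = cong (+_ ∘ suc) (+-identityʳ N-1)

sumFin-cong : ∀ K {f g : Fin K → ℚ} → (∀ i → f i ≡ g i) → sumFin K f ≡ sumFin K g
sumFin-cong zero    _   = refl
sumFin-cong (suc K) f≡g = cong₂ ℚ._+_ (f≡g zero) (sumFin-cong K (f≡g ∘ suc))

sumFin-mono : ∀ K {f g : Fin K → ℚ} → (∀ i → f i ℚ.≤ g i) → sumFin K f ℚ.≤ sumFin K g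
sumFin-mono zero    _   = ℚP.≤-refl
sumFin-mono (suc K) f≤g = ℚP.+-mono-≤ (f≤g zero) (sumFin-mono K (f≤g ∘ suc))

/-distrib-sum : ∀ {K} (f : Fin K → ℕ) N .{{_ : NonZero N}} → + sum f ℚ./ N ≡ sumFin K (λ i → + f i ℚ./ N)
/-distrib-sum {zero}  f N = ℚP.0/n≡0 N
/-distrib-sum {suc K} f N = trans (sym (a/n+b/n≡[a+b]/n (f zero) (sum (f ∘ suc)) N))
                                  (cong (+ f zero ℚ./ N ℚ.+_) (/-distrib-sum (f ∘ suc) N))

deviation-bound : ∀ N .{{_ : NonZero N}} (d : Fin N → ℕ) m {c} → N * c ≤ ∑[ w < N ] ∣ N * d w - m ∣ →
                  + c ℚ./ 1 ℚ.≤ sumFin N (λ w → ℚ.∣ + d w ℚ./ 1 ℚ.- + m ℚ./ N ∣)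
deviation-bound N d m {c} Nc≤∑ = begin
  + c ℚ./ 1                                        ≤⟨ n*a≤b⇒a/1≤b/n N Nc≤∑ ⟩
  + (∑[ w < N ] ∣ N * d w - m ∣) ℚ./ N             ≡⟨ /-distrib-sum (λ w → ∣ N * d w - m ∣) N ⟩
  sumFin N (λ w → + ∣ N * d w - m ∣ ℚ./ N)         ≡⟨ sumFin-cong N (λ w → ∣d/1-m/n∣≡∣n*d-m∣/n (d w) m N) ⟨
  sumFin N (λ w → ℚ.∣ + d w ℚ./ 1 ℚ.- + m ℚ./ N ∣) ∎
  where open ℚP.≤-Reasoning

-- Balancing every class

module _ {r : ℕ} {n : Fin r → ℕ} (pos : ∀ k → n k > 0) (H : Hypergraph r n) where

  private instance
    n-nonZero : ∀ {k} → NonZero (n k)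
    n-nonZero {k} = >-nonZero (pos k)

  mean-floor : Fin r → ℕ
  mean-floor k = numEdges H / n k

  budget : Fin r → ℕ
  budget k = 2 * imbalance (mean-floor k) (deg H k)

  open PropositionalMembership using (_∈_; _∉_)
  open PropositionalUnique using (Unique)

  record Progress (ks : List (Fin r)) : Set where
    field
      result    : Hypergraph r n
      balanced  : ∀ {k} → k ∈ ks → Balanced result k
      untouched : ∀ {k} → k ∉ ks → deg result k ≗ deg H k
      same-size : numEdges result ≡ numEdges H
      spent     : symDiffSize H result ≤ ListAction.sum (List.map budget ks)

  balance-classes : ∀ ks → Unique ks → Progress ks
  balance-classes [] [] = record
    { result = H ; balanced = λ () ; untouched = λ _ _ → refl ; same-size = refl
    ; spent = ≤-reflexive (symDiffSize-self H) }
  balance-classes (k ∷ ks) (k∉ks ∷ ks!) = record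
    { result    = graph E
    ; balanced  = balanced-on
    ; untouched = λ k′∉k∷ks w → trans (elsewhere E (k′∉k∷ks ∘ here) w) (untouched P (k′∉k∷ks ∘ there) w)
    ; same-size = trans (size E) (same-size P)
    ; spent     = begin
        symDiffSize H (graph E)                     ≤⟨ symDiffSize-triangle H (result P) (graph E) ⟩
        symDiffSize H (result P) + symDiffSize (result P) (graph E) ≤⟨ +-mono-≤ (spent P) (cost E) ⟩
        ListAction.sum (List.map budget ks) + 2 * imbalance q (deg (result P) k)
          ≡⟨ cong (λ i → ListAction.sum (List.map budget ks) + 2 * i) (imbalance-cong q (untouched P k∉ks′)) ⟩
        ListAction.sum (List.map budget ks) + budget k ≡⟨ +-comm _ (budget k) ⟩
        ListAction.sum (List.map budget (k ∷ ks))  ∎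
    }
    where
    open Progress
    open ≤-Reasoning
    P : Progress ks
    P = balance-classes ks ks!
    q : ℕ
    q = mean-floor k
    k∉ks′ : k ∉ ks
    k∉ks′ = All.All¬⇒¬Any k∉ks
    balanced-step : Σ[ E ∈ Edit (result P) k (2 * imbalance q (deg (result P) k)) ] Balanced (graph E) k
    balanced-step = balance-class (imbalance q (deg (result P) k)) (result P) k q
      (subst (n k * q ≤_) (sym (same-size P)) (n*[m/n]≤m (numEdges H) (n k)))
      (subst (_< n k * suc q) (sym (same-size P)) (m<n*[1+m/n] (numEdges H) (n k))) ≤-refl
    E : Edit (result P) k (2 * imbalance q (deg (result P) k))
    E = proj₁ balanced-step
    balanced-on : ∀ {k′} → k′ ∈ k ∷ ks → Balanced (graph E) k′
    balanced-on (here refl)   = proj₂ balanced-step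
    balanced-on (there k′∈ks) =
      Balanced-resp {G = result P} {G′ = graph E} (λ w → sym (elsewhere E (≢-sym (All.lookup k∉ks k′∈ks)) w))
                    (balanced P k′∈ks)

  budget-bound : ∀ k →
    + budget k ℚ./ 1 ℚ.≤ sumFin (n k) (λ j → ℚ.∣ + deg H k j ℚ./ 1 ℚ.- + numEdges H ℚ./ n k ∣)
  budget-bound k = deviation-bound (n k) (deg H k) (numEdges H)
    (imbalance-bound (mean-floor k) (deg H k) (numEdges H) (deg-sum H k)
      (n*[m/n]≤m (numEdges H) (n k)) (m<n*[1+m/n] (numEdges H) (n k)))

corollary3p4 : (r : ℕ) (n : Fin r → ℕ) (pos : ∀ i → n i > 0) (H : Hypergraph r n) →
    ∃ λ (Ĥ : Hypergraph r n) →
      (∀ (k : Fin r) (a b : Fin (n k)) → ∣ deg Ĥ k a - deg Ĥ k b ∣ ≤ 1)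
      × ((+ symDiffSize H Ĥ) ℚ./ 1) ℚ.≤ s-r pos H
corollary3p4 r n pos H = result P , (λ k → balanced P (∈-allFin k)) , (begin
  + symDiffSize H (result P) ℚ./ 1                            ≤⟨ n*a≤b⇒a/1≤b/n 1 (≤-trans (≤-reflexive (*-identityˡ _)) (spent P)) ⟩
  + ListAction.sum (List.map (budget pos H) (allFin r)) ℚ./ 1 ≡⟨ cong (λ s → + s ℚ./ 1) (sum-allFin (budget pos H)) ⟩
  + sum (budget pos H) ℚ./ 1                                  ≡⟨ /-distrib-sum (budget pos H) 1 ⟩
  sumFin r (λ k → + budget pos H k ℚ./ 1)                     ≤⟨ sumFin-mono r (budget-bound pos H) ⟩
  s-r pos H                                                   ∎)
  where
  open Progress
  open ℚP.≤-Reasoning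
  P : Progress pos H (allFin r)
  P = balance-classes pos H (allFin r) (allFin⁺ r)
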